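{- Let $G$ be a graph, $(G=G_1,\ldots,G_n)$ a contraction sequence of width $d$, and $k\in\mathbb N$. If $i\in[2,n]$, $\pi$ is an extended $i$-profile, $\{\pi_j:j\in[m]\}$ is an $f'$-decomposition of $\pi$ (for some function $f'$ compatible with $\pi$), and $S_j$ is a solution of $\pi_j$ for each $j\in[m]$, then $S:=\bigcup_{j\in[m]}S_j$ is a solution of $\pi$.
   Context: Graphs are finite, simple, undirected. A trigraph has edges partitioned into black edges and red edges; ordinary graphs have no red edges. Contracting distinct vertices $u,v$ of a trigraph deletes $u,v$ and adds a new vertex $w$ with a black edge $wx$ for each $x$ with $xu,xv$ both black, and a red edge $wy$ for each $y$ with $yu$ or $yv$ red, or with $y$ black-adjacent to exactly one of $u,v$ and non-adjacent to the other. A contraction sequence $(G=G_1,\ldots,G_n)$ has $|V(G_n)|=1$ and each $G_{i+1}$ obtained from $G_i$ by one contraction; its width is the maximum red degree over all $G_i$. Bags: $\beta(u)=\{u\}$ for $u\in V(G)$, $\beta(w)=\beta(u)\cup\beta(v)$ if $w$ arises by contracting $u,v$; $\beta(X)=\bigcup_{u\in X}\beta(u)$. A basic $i$-profile is $(T,D)$ with $T\subseteq V(G_i)$, $|T|\le k(d+1)$, $T$ connected via red edges of $G_i$, $D\subseteq T$, $|D|\le k$. An extended $i$-profile is $(T,D,M,f)$ with $(T,D)$ a basic $i$-profile, $M\subseteq T$, $f:T\to[0,k]$, $\sum_{u\in T}f(u)\le k$, $f(u)\le|\beta(u)|$ for $u\in T$, $D=\{u\in T:f(u)\ne0\}$.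 A set $S\subseteq\beta(T)$ is a solution of $(T,D,M,f)$ if $|S\cap\beta(u)|=f(u)$ for all $u\in T$. Let $\{v\}=V(G_i)\setminus V(G_{i-1})$, $\{u_1,u_2\}=V(G_{i-1})\setminus V(G_i)$, $\pi=(T,D,M,f)$ with $v\in T$, and $T'=(T\setminus\{v\})\cup\{u_1,u_2\}$. For $\pi_0=(T,D)$: $D'\subseteq T'$ is compatible with $\pi_0$ if $D\setminus\{v\}=D'\setminus\{u_1,u_2\}$, $|D'|\le k$, and $v\in D$ iff $u_1\in D'$ or $u_2\in D'$; a set $\{(T_1,D_1),\ldots,(T_m,D_m)\}$ of basic $(i-1)$-profiles is a $D'$-decomposition of $\pi_0$ if the $T_j$ are pairwise disjoint, $T'=\bigcup_jT_j$, $D'=\bigcup_jD_j$, $D'$ is compatible with $\pi_0$, and no red edge of $G_{i-1}$ joins $x\in T_j$ to $y\in D_\ell$ with $j\ne\ell$. A function $f':T'\to[0,k]$ is compatible with $\pi$ if $f(v)=f'(u_1)+f'(u_2)$, $f'(u_1)\le|\beta(u_1)|$, $f'(u_2)\le|\beta(u_2)|$, and $f'(u)=f(u)$ for $u\in T\setminus\{v\}$. With $D'=\{u\in T':f'(u)\ne0\}$, $\hat M=(M\setminus\{v\})\cup\{u_1,u_2\}$ if $v\in M$ and $\hat M=M$ otherwise, and $M'=\{u\in\hat M:u$ has no black neighbor in $D'$ in $G_{i-1}\}$, a set $\{(T_j,D_j,M_j,f_j):j\in[m]\}$ of extended $(i-1)$-profiles is an $f'$-decomposition of $\pi$ if $f'=\bigcup_jf_j$,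 $D'=\bigcup_jD_j$, $M'=\bigcup_jM_j$, and $\{(T_j,D_j)\}$ is a $D'$-decomposition of $\pi_0$. -}

module Defs where

open import Data.Nat using (ℕ; zero; suc; _+_; _*_; _∸_; _≤_; _<_)
open import Data.Bool using (Bool; true; false; _∧_; _∨_; not; if_then_else_)
open import Data.Fin using (Fin; _≟_)
open import Data.Fin.Subset using (Subset; _∈_; _∉_; _⊆_; _∪_; _∩_; ⁅_⁆; ∣_∣; _─_)
open import Data.Fin.Subset.Properties using (_∈?_)
open import Data.Vec using (Vec; tabulate; sum)
open import Data.Product using (Σ; ∃; _×_; _,_)
open import Data.Sum using (_⊎_)
open import Relation.Nullary using (¬_; yes; no; does)
open import Relation.Binary.PropositionalEquality using (_≡_; _≢_)
open import Function.Bundles using (_⇔_)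

-- Trigraphs.  All vertices (of G and of every G_i) are drawn from a
-- fixed finite universe Fin U.  A trigraph is a vertex set together with
-- Boolean black / red edge indicators.

record Trigraph (U : ℕ) : Set where
  constructor mkTrigraph
  field
    V     : Subset U
    black : Fin U → Fin U → Bool
    red   : Fin U → Fin U → Bool
open Trigraph public

record IsTrigraph {U : ℕ} (H : Trigraph U) : Set where
  field
    black-sym   : ∀ x y → black H x y ≡ black H y x
    red-sym     : ∀ x y → red H x y ≡ red H y x
    black-irr   : ∀ x → black H x x ≡ false
    red-irr     : ∀ x → red H x x ≡ false
    black-in-V  : ∀ x y → black H x y ≡ true → x ∈ V H × y ∈ V H
    red-in-V    : ∀ x y → red H x y ≡ true → x ∈ V H × y ∈ V H
    disjoint    : ∀ x y → black H x y ≡ true → red H x y ≡ false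

IsGraph : {U : ℕ} → Trigraph U → Set
IsGraph H = IsTrigraph H × (∀ x y → red H x y ≡ false)

nonadj : {U : ℕ} → Trigraph U → Fin U → Fin U → Bool
nonadj H x y = not (black H x y ∨ red H x y)

record Contraction {U : ℕ} (H : Trigraph U) (u v w : Fin U) (H' : Trigraph U) : Set where
  field
    u∈V     : u ∈ V H
    v∈V     : v ∈ V H
    u≢v     : u ≢ v
    w-new   : w ∉ V H
    vertices : ∀ x → (x ∈ V H' ⇔ (x ≡ w ⊎ (x ∈ V H × x ≢ u × x ≢ v)))
    old-black : ∀ x y → x ∈ V H' → y ∈ V H' → x ≢ w → y ≢ w →
                black H' x y ≡ black H x y
    old-red   : ∀ x y → x ∈ V H' → y ∈ V H' → x ≢ w → y ≢ w →
                red H' x y ≡ red H x y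
    new-black : ∀ x → x ∈ V H' → x ≢ w →
                black H' w x ≡ (black H x u ∧ black H x v)
    new-red   : ∀ x → x ∈ V H' → x ≢ w →
                red H' w x ≡ (red H x u ∨ red H x v
                              ∨ (black H x u ∧ nonadj H x v)
                              ∨ (black H x v ∧ nonadj H x u))

redDeg : {U : ℕ} → Trigraph U → Fin U → ℕ
redDeg H x = ∣ tabulate (λ y → red H x y) ∣

-- Contraction sequences (G = G_1 , … , G_n), indexed 1..n.
-- cu i , cv i are contracted in G_i into the new vertex cw i of G_{i+1}.

record ContractionSeq {U : ℕ} (G : Trigraph U) (n : ℕ) : Set where
  field
    Gs      : ℕ → Trigraph U
    cu cv cw : ℕ → Fin U
    n≥1     : 1 ≤ n
    start   : Gs 1 ≡ G
    trig    : ∀ i → 1 ≤ i → i ≤ n → IsTrigraph (Gs i)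
    steps   : ∀ i → 1 ≤ i → i < n → Contraction (Gs i) (cu i) (cv i) (cw i) (Gs (suc i))
    final   : ∣ V (Gs n) ∣ ≡ 1
open ContractionSeq public

HasWidth : {U : ℕ} {G : Trigraph U} {n : ℕ} → ContractionSeq G n → ℕ → Set
HasWidth {n = n} σ d =
  (∀ i → 1 ≤ i → i ≤ n → ∀ x → x ∈ V (Gs σ i) → redDeg (Gs σ i) x ≤ d)
  × Σ ℕ (λ i → 1 ≤ i × i ≤ n × Σ _ (λ x → x ∈ V (Gs σ i) × redDeg (Gs σ i) x ≡ d))

bag : {U : ℕ} {G : Trigraph U} {n : ℕ} → ContractionSeq G n → ℕ → Fin U → Subset U
bag σ zero x = ⁅ x ⁆
bag σ (suc zero) x = ⁅ x ⁆
bag σ (suc (suc i)) x =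
  if does (x ≟ cw σ (suc i))
  then bag σ (suc i) (cu σ (suc i)) ∪ bag σ (suc i) (cv σ (suc i))
  else bag σ (suc i) x

_∈bags_ : {U : ℕ} {G : Trigraph U} {n : ℕ} → Fin U → (ContractionSeq G n × ℕ × Subset U) → Set
y ∈bags (σ , i , T) = ∃ λ x → x ∈ T × y ∈ bag σ i x

data RedPath {U : ℕ} (H : Trigraph U) (T : Subset U) : Fin U → Fin U → Set where
  here : ∀ {x} → RedPath H T x x
  step : ∀ {x y z} → red H x y ≡ true → y ∈ T → RedPath H T y z → RedPath H T x z

RedConnected : {U : ℕ} → Trigraph U → Subset U → Set
RedConnected H T = ∀ x y → x ∈ T → y ∈ T → RedPath H T x y

sumOver : {U : ℕ} → Subset U → (Fin U → ℕ) → ℕ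
sumOver T f = sum (tabulate (λ x → if does (x ∈? T) then f x else 0))

support : {U : ℕ} → Subset U → (Fin U → ℕ) → Subset U
support T f = tabulate (λ x → does (x ∈? T) ∧ not (does (f x Data.Nat.≟ 0)))

-- Profiles.  A function T → [0,k] is represented by f : Fin U → ℕ which
-- vanishes outside T.

module _ {U : ℕ} {G : Trigraph U} {n : ℕ} (σ : ContractionSeq G n) (k d : ℕ) where

  record IsBasicProfile (i : ℕ) (T D : Subset U) : Set where
    field
      T⊆V    : T ⊆ V (Gs σ i)
      T-size : ∣ T ∣ ≤ k * (d + 1)
      T-conn : RedConnected (Gs σ i) T
      D⊆T    : D ⊆ T
      D-size : ∣ D ∣ ≤ k

  record ExtProfile : Set where
    constructor ⟨_,_,_,_⟩
    field
      PT PD PM : Subset U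
      Pf       : Fin U → ℕ
  open ExtProfile public

  record IsExtProfile (i : ℕ) (π : ExtProfile) : Set where
    field
      basic  : IsBasicProfile i (PT π) (PD π)
      M⊆T    : PM π ⊆ PT π
      f≤k    : ∀ x → Pf π x ≤ k
      f-out  : ∀ x → x ∉ PT π → Pf π x ≡ 0
      f-sum  : sumOver (PT π) (Pf π) ≤ k
      f≤bag  : ∀ x → x ∈ PT π → Pf π x ≤ ∣ bag σ i x ∣
      D-def  : PD π ≡ support (PT π) (Pf π)

  IsSolution : ℕ → ExtProfile → Subset U → Set
  IsSolution i π S =
    (∀ y → y ∈ S → y ∈bags (σ , i , PT π))
    × (∀ x → x ∈ PT π → ∣ S ∩ bag σ i x ∣ ≡ Pf π x)

  DCompatible : (v u₁ u₂ : Fin U) → (T D D' : Subset U) → Set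
  DCompatible v u₁ u₂ T D D' =
    (D ─ ⁅ v ⁆ ≡ D' ─ (⁅ u₁ ⁆ ∪ ⁅ u₂ ⁆))
    × ∣ D' ∣ ≤ k
    × (v ∈ D ⇔ (u₁ ∈ D' ⊎ u₂ ∈ D'))

  T'of : (v u₁ u₂ : Fin U) → Subset U → Subset U
  T'of v u₁ u₂ T = (T ─ ⁅ v ⁆) ∪ (⁅ u₁ ⁆ ∪ ⁅ u₂ ⁆)

  record IsDDecomposition (i : ℕ) (v u₁ u₂ : Fin U) (T D D' : Subset U)
                          (m : ℕ) (Ts Ds : Fin m → Subset U) : Set where
    field
      basics   : ∀ j → IsBasicProfile (i ∸ 1) (Ts j) (Ds j)
      disjoint : ∀ j ℓ → j ≢ ℓ → ∀ x → x ∈ Ts j → x ∉ Ts ℓ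
      cover-T  : ∀ x → x ∈ T'of v u₁ u₂ T ⇔ (∃ λ j → x ∈ Ts j)
      cover-D  : ∀ x → x ∈ D' ⇔ (∃ λ j → x ∈ Ds j)
      compat   : DCompatible v u₁ u₂ T D D'
      no-red   : ∀ j ℓ → j ≢ ℓ → ∀ x y → x ∈ Ts j → y ∈ Ds ℓ →
                 red (Gs σ (i ∸ 1)) x y ≡ false

  FCompatible : (i : ℕ) (v u₁ u₂ : Fin U) → ExtProfile → (Fin U → ℕ) → Set
  FCompatible i v u₁ u₂ π f' =
    (∀ x → f' x ≤ k)
    × (∀ x → x ∉ T'of v u₁ u₂ (PT π) → f' x ≡ 0)
    × (Pf π v ≡ f' u₁ + f' u₂)
    × (f' u₁ ≤ ∣ bag σ (i ∸ 1) u₁ ∣)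
    × (f' u₂ ≤ ∣ bag σ (i ∸ 1) u₂ ∣)
    × (∀ u → u ∈ PT π → u ≢ v → f' u ≡ Pf π u)

  Mhat : (v u₁ u₂ : Fin U) → Subset U → Subset U
  Mhat v u₁ u₂ M =
    if does (v ∈? M) then (M ─ ⁅ v ⁆) ∪ (⁅ u₁ ⁆ ∪ ⁅ u₂ ⁆) else M

  M'of : (i : ℕ) (v u₁ u₂ : Fin U) → Subset U → Subset U → Subset U
  M'of i v u₁ u₂ M D' =
    tabulate (λ u → does (u ∈? Mhat v u₁ u₂ M)
                    ∧ not (Data.Vec.foldr _ _∨_ false
                             (tabulate (λ y → does (y ∈? D') ∧ black (Gs σ (i ∸ 1)) u y))))

  record IsFDecomposition (i : ℕ) (v u₁ u₂ : Fin U) (π : ExtProfile) (f' : Fin U → ℕ)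
                          (m : ℕ) (πs : Fin m → ExtProfile) : Set where
    D' : Subset U
    D' = support (T'of v u₁ u₂ (PT π)) f'
    field
      exts     : ∀ j → IsExtProfile (i ∸ 1) (πs j)
      f-union  : ∀ j x → x ∈ PT (πs j) → f' x ≡ Pf (πs j) x
      D-union  : ∀ x → x ∈ D' ⇔ (∃ λ j → x ∈ PD (πs j))
      M-union  : ∀ x → x ∈ M'of i v u₁ u₂ (PM π) D' ⇔ (∃ λ j → x ∈ PM (πs j))
      ddecomp  : IsDDecomposition i v u₁ u₂ (PT π) (PD π) D' m
                   (λ j → PT (πs j)) (λ j → PD (πs j))

⋃ᶠ : {U m : ℕ} → (Fin m → Subset U) → Subset U
⋃ᶠ {m = zero} S = Data.Fin.Subset.⊥
⋃ᶠ {m = suc m} S = S Fin.zero ∪ ⋃ᶠ (λ j → S (Fin.suc j))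

-- The bags of the vertices of each G_i are pairwise disjoint, and the bag
-- of the new vertex v of G_i is the disjoint union of the bags of u₁ and u₂.
-- Since the parts T_j of the decomposition are disjoint, the only part of
-- ⋃ S_j meeting the bag of a vertex x ∈ T_j is S_j, which meets it in
-- f'(x) elements.  Hence ⋃ S_j meets β(v) in f'(u₁) + f'(u₂) = f(v)
-- elements and every other β(x), x ∈ T, in f'(x) = f(x) elements.
module Submission where

open import Defs
open import Data.Nat using (ℕ; zero; suc; _+_; _≤_; _<_; _∸_; s≤s; z≤n)
open import Data.Nat.Properties using (+-suc; ≤-trans; n≤1+n)
open import Data.Fin using (Fin; _≟_) renaming (zero to fzero; suc to fsuc)
open import Data.Fin.Subset
  using (Subset; _∈_; _∉_; _⊆_; _∪_; _∩_; _─_; ⁅_⁆; ∣_∣; Empty; inside; outside)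
open import Data.Fin.Subset.Properties
  using ( ∉⊥; x∈⁅y⁆⇒x≡y; x≢y⇒x∉⁅y⁆; x∈⁅x⁆; x∈p∪q⁺; x∈p∪q⁻; x∈p∩q⁺; x∈p∩q⁻
        ; x∈p∧x∉q⇒x∈p─q; p─q⊆p; ⊆-antisym; ∪-comm; ∩-distribˡ-∪ )
open import Data.Vec.Base using (_∷_; []; here; there)
open import Data.Product using (∃; _×_; _,_; proj₁; proj₂)
open import Data.Sum using (_⊎_; inj₁; inj₂)
open import Data.Empty using (⊥; ⊥-elim)
open import Relation.Nullary using (Dec; yes; no; contradiction)
open import Relation.Binary.PropositionalEquality
  using (_≡_; _≢_; refl; sym; trans; cong; cong₂; subst; module ≡-Reasoning)
open import Function.Bundles using (Equivalence)

private
  variable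
    U m : ℕ

∣p∪q∣≡∣p∣+∣q∣ : (p q : Subset U) → Empty (p ∩ q) → ∣ p ∪ q ∣ ≡ ∣ p ∣ + ∣ q ∣
∣p∪q∣≡∣p∣+∣q∣ []            []            _ = refl
∣p∪q∣≡∣p∣+∣q∣ (inside  ∷ p) (inside  ∷ q) e = contradiction (fzero , here) e
∣p∪q∣≡∣p∣+∣q∣ (inside  ∷ p) (outside ∷ q) e =
  cong suc (∣p∪q∣≡∣p∣+∣q∣ p q (λ (x , h) → e (fsuc x , there h)))
∣p∪q∣≡∣p∣+∣q∣ (outside ∷ p) (inside  ∷ q) e =
  trans (cong suc (∣p∪q∣≡∣p∣+∣q∣ p q (λ (x , h) → e (fsuc x , there h))))
        (sym (+-suc ∣ p ∣ ∣ q ∣))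
∣p∪q∣≡∣p∣+∣q∣ (outside ∷ p) (outside ∷ q) e =
  ∣p∪q∣≡∣p∣+∣q∣ p q (λ (x , h) → e (fsuc x , there h))

∣p∩[q∪r]∣≡∣p∩q∣+∣p∩r∣ : (p q r : Subset U) → Empty (q ∩ r) →
                         ∣ p ∩ (q ∪ r) ∣ ≡ ∣ p ∩ q ∣ + ∣ p ∩ r ∣
∣p∩[q∪r]∣≡∣p∩q∣+∣p∩r∣ p q r q∩r-empty =
  trans (cong ∣_∣ (∩-distribˡ-∪ p q r))
        (∣p∪q∣≡∣p∣+∣q∣ (p ∩ q) (p ∩ r) λ (x , h) →
          q∩r-empty (x , x∈p∩q⁺ (proj₂ (x∈p∩q⁻ p q (proj₁ (x∈p∩q⁻ _ _ h))) ,
                                 proj₂ (x∈p∩q⁻ p r (proj₂ (x∈p∩q⁻ _ _ h))))))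

x∈p─q⇒x∉q : {x : Fin U} (p q : Subset U) → x ∈ p ─ q → x ∉ q
x∈p─q⇒x∉q (inside ∷ p) (outside ∷ q) here      ()
x∈p─q⇒x∉q (_      ∷ p) (_       ∷ q) (there h) (there h') = x∈p─q⇒x∉q p q h h'

x∈⁅y⁆∪⁅z⁆⁻ : {x y z : Fin U} → x ∈ ⁅ y ⁆ ∪ ⁅ z ⁆ → x ≡ y ⊎ x ≡ z
x∈⁅y⁆∪⁅z⁆⁻ {y = y} {z} h with x∈p∪q⁻ ⁅ y ⁆ ⁅ z ⁆ h
... | inj₁ h₁ = inj₁ (x∈⁅y⁆⇒x≡y y h₁)
... | inj₂ h₂ = inj₂ (x∈⁅y⁆⇒x≡y z h₂)

distinct∈⁅x⁆∪⁅y⁆ : {a b x y : Fin U} → a ≢ b →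
                  a ∈ ⁅ x ⁆ ∪ ⁅ y ⁆ → b ∈ ⁅ x ⁆ ∪ ⁅ y ⁆ →
                  (a ≡ x × b ≡ y) ⊎ (a ≡ y × b ≡ x)
distinct∈⁅x⁆∪⁅y⁆ a≢b a∈ b∈ with x∈⁅y⁆∪⁅z⁆⁻ a∈ | x∈⁅y⁆∪⁅z⁆⁻ b∈
... | inj₁ a≡x | inj₂ b≡y = inj₁ (a≡x , b≡y)
... | inj₂ a≡y | inj₁ b≡x = inj₂ (a≡y , b≡x)
... | inj₁ a≡x | inj₁ b≡x = contradiction (trans a≡x (sym b≡x)) a≢b
... | inj₂ a≡y | inj₂ b≡y = contradiction (trans a≡y (sym b≡y)) a≢b

x∈⋃ᶠ⁺ : (S : Fin m → Subset U) (j : Fin m) {y : Fin U} → y ∈ S j → y ∈ ⋃ᶠ S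
x∈⋃ᶠ⁺ S fzero    h = x∈p∪q⁺ (inj₁ h)
x∈⋃ᶠ⁺ S (fsuc j) h = x∈p∪q⁺ (inj₂ (x∈⋃ᶠ⁺ (λ l → S (fsuc l)) j h))

x∈⋃ᶠ⁻ : (S : Fin m → Subset U) {y : Fin U} → y ∈ ⋃ᶠ S → ∃ λ j → y ∈ S j
x∈⋃ᶠ⁻ {m = zero}  S h = ⊥-elim (∉⊥ h)
x∈⋃ᶠ⁻ {m = suc m} S h with x∈p∪q⁻ (S fzero) (⋃ᶠ (λ l → S (fsuc l))) h
... | inj₁ h₀ = fzero , h₀
... | inj₂ h' with x∈⋃ᶠ⁻ (λ l → S (fsuc l)) h'
...   | j , hⱼ = fsuc j , hⱼ

⋃ᶠ∩-local : (S : Fin m → Subset U) (B : Subset U) (j : Fin m) →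
            (∀ l → l ≢ j → ∀ {y} → y ∈ S l → y ∉ B) → ⋃ᶠ S ∩ B ≡ S j ∩ B
⋃ᶠ∩-local S B j apart = ⊆-antisym ⋃⊆ⱼ ⱼ⊆⋃
  where
  ⋃⊆ⱼ : ⋃ᶠ S ∩ B ⊆ S j ∩ B
  ⋃⊆ⱼ h with x∈p∩q⁻ (⋃ᶠ S) B h
  ... | y∈⋃ , y∈B with x∈⋃ᶠ⁻ S y∈⋃
  ...   | l , y∈Sₗ with l ≟ j
  ...     | yes refl = x∈p∩q⁺ (y∈Sₗ , y∈B)
  ...     | no l≢j   = contradiction y∈B (apart l l≢j y∈Sₗ)
  ⱼ⊆⋃ : S j ∩ B ⊆ ⋃ᶠ S ∩ B
  ⱼ⊆⋃ h with x∈p∩q⁻ (S j) B h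
  ... | y∈Sⱼ , y∈B = x∈p∩q⁺ (x∈⋃ᶠ⁺ S j y∈Sⱼ , y∈B)

module _ {H H' : Trigraph U} {u v w : Fin U} (C : Contraction H u v w H') where

  open Contraction C

  contracted∈V' : w ∈ V H'
  contracted∈V' = Equivalence.from (vertices w) (inj₁ refl)

  ∈V⇒≢contracted : ∀ {x} → x ∈ V H → x ≢ w
  ∈V⇒≢contracted x∈V refl = w-new x∈V

  survivor : ∀ {x} → x ∈ V H' → x ≢ w → x ∈ V H × x ≢ u × x ≢ v
  survivor {x} x∈V' x≢w with Equivalence.to (vertices x) x∈V'
  ... | inj₁ x≡w = contradiction x≡w x≢w
  ... | inj₂ old = old

  left∉V' : u ∉ V H'
  left∉V' u∈V' = proj₁ (proj₂ (survivor u∈V' (∈V⇒≢contracted u∈V))) refl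

  right∉V' : v ∉ V H'
  right∉V' v∈V' = proj₂ (proj₂ (survivor v∈V' (∈V⇒≢contracted v∈V))) refl

module _ {G : Trigraph U} {n : ℕ} (σ : ContractionSeq G n) where

  bag-contracted : ∀ j → bag σ (suc (suc j)) (cw σ (suc j))
                         ≡ bag σ (suc j) (cu σ (suc j)) ∪ bag σ (suc j) (cv σ (suc j))
  bag-contracted j with cw σ (suc j) ≟ cw σ (suc j)
  ... | yes _  = refl
  ... | no w≢w = contradiction refl w≢w

  bag-untouched : ∀ j x → x ≢ cw σ (suc j) → bag σ (suc (suc j)) x ≡ bag σ (suc j) x
  bag-untouched j x x≢w with x ≟ cw σ (suc j)
  ... | yes x≡w = contradiction x≡w x≢w
  ... | no _    = refl

  BagsDisjoint : ℕ → Set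
  BagsDisjoint i = ∀ x y → x ∈ V (Gs σ i) → y ∈ V (Gs σ i) → x ≢ y →
                   ∀ {z} → z ∈ bag σ i x → z ∈ bag σ i y → ⊥

  bags-disjoint-step : ∀ j → suc j < n → BagsDisjoint (suc j) → BagsDisjoint (suc (suc j))
  bags-disjoint-step j j<n disj = go
    where
    C = steps σ (suc j) (s≤s z≤n) j<n
    w = cw σ (suc j)

    old-vs-new : ∀ {x y z} → y ∈ V (Gs σ (suc (suc j))) → y ≢ w → x ≡ w →
                 z ∈ bag σ (suc (suc j)) y → z ∈ bag σ (suc (suc j)) x → ⊥
    old-vs-new {y = y} y∈V y≢w refl z∈y z∈w
      with survivor C y∈V y≢w | x∈p∪q⁻ _ _ (subst (_ ∈_) (bag-contracted j) z∈w)
    ... | y∈V₀ , y≢u , _ | inj₁ z∈u =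
      disj y _ y∈V₀ (Contraction.u∈V C) y≢u (subst (_ ∈_) (bag-untouched j y y≢w) z∈y) z∈u
    ... | y∈V₀ , _ , y≢v | inj₂ z∈v =
      disj y _ y∈V₀ (Contraction.v∈V C) y≢v (subst (_ ∈_) (bag-untouched j y y≢w) z∈y) z∈v

    go : BagsDisjoint (suc (suc j))
    go x y x∈V y∈V x≢y z∈x z∈y = split (x ≟ w) (y ≟ w)
      where
      -- A `with` on x ≟ w would unfold the bags in the types of z∈x and z∈y.
      split : Dec (x ≡ w) → Dec (y ≡ w) → ⊥
      split (yes x≡w) (yes y≡w) = x≢y (trans x≡w (sym y≡w))
      split (no x≢w)  (yes y≡w) = old-vs-new x∈V x≢w y≡w z∈x z∈y
      split (yes x≡w) (no y≢w)  = old-vs-new y∈V y≢w x≡w z∈y z∈x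
      split (no x≢w)  (no y≢w)  =
        disj x y (proj₁ (survivor C x∈V x≢w)) (proj₁ (survivor C y∈V y≢w)) x≢y
          (subst (_ ∈_) (bag-untouched j x x≢w) z∈x)
          (subst (_ ∈_) (bag-untouched j y y≢w) z∈y)

  bags-disjoint : ∀ i → 1 ≤ i → i ≤ n → BagsDisjoint i
  bags-disjoint (suc zero) _ _ x y _ _ x≢y z∈x z∈y =
    x≢y (trans (sym (x∈⁅y⁆⇒x≡y x z∈x)) (x∈⁅y⁆⇒x≡y y z∈y))
  bags-disjoint (suc (suc j)) _ j<n =
    bags-disjoint-step j j<n (bags-disjoint (suc j) (s≤s z≤n) (≤-trans (n≤1+n _) j<n))

  module Step (j : ℕ) (j<n : suc j < n) {v u₁ u₂ : Fin U}
              (new≡ : V (Gs σ (suc (suc j))) ─ V (Gs σ (suc j)) ≡ ⁅ v ⁆)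
              (removed≡ : V (Gs σ (suc j)) ─ V (Gs σ (suc (suc j))) ≡ ⁅ u₁ ⁆ ∪ ⁅ u₂ ⁆)
              where

    private
      C = steps σ (suc j) (s≤s z≤n) j<n
      w = cw σ (suc j)

      removed : ∀ {x} → x ∈ V (Gs σ (suc j)) → x ∉ V (Gs σ (suc (suc j))) → x ∈ ⁅ u₁ ⁆ ∪ ⁅ u₂ ⁆
      removed x∈ x∉ = subst (_ ∈_) removed≡ (x∈p∧x∉q⇒x∈p─q x∈ x∉)

    w≡v : w ≡ v
    w≡v = x∈⁅y⁆⇒x≡y v (subst (w ∈_) new≡
            (x∈p∧x∉q⇒x∈p─q (contracted∈V' C) (Contraction.w-new C)))

    removed∈V : ∀ {x} → x ∈ ⁅ u₁ ⁆ ∪ ⁅ u₂ ⁆ → x ∈ V (Gs σ (suc j))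
    removed∈V h = p─q⊆p _ _ (subst (_ ∈_) (sym removed≡) h)

    bag-merged : bag σ (suc (suc j)) v ≡ bag σ (suc j) u₁ ∪ bag σ (suc j) u₂
    bag-merged
      with distinct∈⁅x⁆∪⁅y⁆ (Contraction.u≢v C)
             (removed (Contraction.u∈V C) (left∉V' C))
             (removed (Contraction.v∈V C) (right∉V' C))
    ... | inj₁ (refl , refl) = subst (λ x → bag σ (suc (suc j)) x ≡ _) w≡v (bag-contracted j)
    ... | inj₂ (refl , refl) =
      subst (λ x → bag σ (suc (suc j)) x ≡ _) w≡v (trans (bag-contracted j) (∪-comm _ _))

    bag-kept : ∀ {x} → x ≢ v → bag σ (suc (suc j)) x ≡ bag σ (suc j) x
    bag-kept x≢v = bag-untouched j _ (λ x≡w → x≢v (trans x≡w w≡v))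

    ∈bags-lift : ∀ {T y} → v ∈ T → y ∈bags (σ , suc j , (T ─ ⁅ v ⁆) ∪ (⁅ u₁ ⁆ ∪ ⁅ u₂ ⁆)) →
                 y ∈bags (σ , suc (suc j) , T)
    ∈bags-lift {T} {y} v∈T (z , z∈T' , y∈βz) with x∈p∪q⁻ (T ─ ⁅ v ⁆) _ z∈T'
    ... | inj₁ z∈T─v = z , p─q⊆p _ _ z∈T─v , subst (_ ∈_) (sym (bag-kept z≢v)) y∈βz
      where
      z≢v : z ≢ v
      z≢v refl = x∈p─q⇒x∉q T ⁅ v ⁆ z∈T─v (x∈⁅x⁆ v)
    ... | inj₂ z∈u₁u₂ = v , v∈T , subst (_ ∈_) (sym bag-merged) (x∈p∪q⁺ y∈β₁∪y∈β₂)
      where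
      y∈β₁∪y∈β₂ : y ∈ bag σ (suc j) u₁ ⊎ y ∈ bag σ (suc j) u₂
      y∈β₁∪y∈β₂ with x∈⁅y⁆∪⁅z⁆⁻ z∈u₁u₂
      ... | inj₁ refl = inj₁ y∈βz
      ... | inj₂ refl = inj₂ y∈βz

    count-lift : ∀ {T} (A : Subset U) (f' f : Fin U → ℕ) → u₁ ≢ u₂ →
                 (∀ {x} → x ∈ (T ─ ⁅ v ⁆) ∪ (⁅ u₁ ⁆ ∪ ⁅ u₂ ⁆) → ∣ A ∩ bag σ (suc j) x ∣ ≡ f' x) →
                 f v ≡ f' u₁ + f' u₂ → (∀ x → x ∈ T → x ≢ v → f' x ≡ f x) →
                 ∀ x → x ∈ T → ∣ A ∩ bag σ (suc (suc j)) x ∣ ≡ f x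
    count-lift {T} A f' f u₁≢u₂ count' f-split f-kept x x∈T with x ≟ v
    ... | yes refl = begin
      ∣ A ∩ bag σ (suc (suc j)) v ∣                      ≡⟨ cong (λ B → ∣ A ∩ B ∣) bag-merged ⟩
      ∣ A ∩ (bag σ (suc j) u₁ ∪ bag σ (suc j) u₂) ∣     ≡⟨ ∣p∩[q∪r]∣≡∣p∩q∣+∣p∩r∣ A _ _ β₁∩β₂-empty ⟩
      ∣ A ∩ bag σ (suc j) u₁ ∣ + ∣ A ∩ bag σ (suc j) u₂ ∣ ≡⟨ cong₂ _+_ (count' (removed∈T' (inj₁ refl)))
                                                                      (count' (removed∈T' (inj₂ refl))) ⟩
      f' u₁ + f' u₂                                      ≡⟨ sym f-split ⟩
      f v                                                ∎
      where
      open ≡-Reasoning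
      removed∈T' : ∀ {z} → z ≡ u₁ ⊎ z ≡ u₂ → z ∈ (T ─ ⁅ v ⁆) ∪ (⁅ u₁ ⁆ ∪ ⁅ u₂ ⁆)
      removed∈T' (inj₁ refl) = x∈p∪q⁺ (inj₂ (x∈p∪q⁺ (inj₁ (x∈⁅x⁆ u₁))))
      removed∈T' (inj₂ refl) = x∈p∪q⁺ (inj₂ (x∈p∪q⁺ (inj₂ (x∈⁅x⁆ u₂))))
      β₁∩β₂-empty : Empty (bag σ (suc j) u₁ ∩ bag σ (suc j) u₂)
      β₁∩β₂-empty (y , h) with x∈p∩q⁻ _ _ h
      ... | y∈β₁ , y∈β₂ =
        bags-disjoint (suc j) (s≤s z≤n) (≤-trans (n≤1+n _) j<n) u₁ u₂
          (removed∈V (x∈p∪q⁺ (inj₁ (x∈⁅x⁆ u₁)))) (removed∈V (x∈p∪q⁺ (inj₂ (x∈⁅x⁆ u₂))))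
          u₁≢u₂ y∈β₁ y∈β₂
    ... | no x≢v = begin
      ∣ A ∩ bag σ (suc (suc j)) x ∣ ≡⟨ cong (λ B → ∣ A ∩ B ∣) (bag-kept x≢v) ⟩
      ∣ A ∩ bag σ (suc j) x ∣       ≡⟨ count' (x∈p∪q⁺ (inj₁ (x∈p∧x∉q⇒x∈p─q x∈T (x≢y⇒x∉⁅y⁆ x≢v)))) ⟩
      f' x                          ≡⟨ f-kept x x∈T x≢v ⟩
      f x                           ∎
      where open ≡-Reasoning

module Gluing {G : Trigraph U} {n : ℕ} (σ : ContractionSeq G n) (k d : ℕ)
         (i : ℕ) (1≤i : 1 ≤ i) (i≤n : i ≤ n) (πs : Fin m → ExtProfile σ k d)
         (T⊆V : ∀ j → PT (πs j) ⊆ V (Gs σ i))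
         (T-disjoint : ∀ j l → j ≢ l → ∀ x → x ∈ PT (πs j) → x ∉ PT (πs l))
         (S : Fin m → Subset U) (sols : ∀ j → IsSolution σ k d i (πs j) (S j))
         where

  ⋃ᶠ-solution-count : ∀ j {x} → x ∈ PT (πs j) → ∣ ⋃ᶠ S ∩ bag σ i x ∣ ≡ Pf (πs j) x
  ⋃ᶠ-solution-count j {x} x∈Tⱼ =
    trans (cong ∣_∣ (⋃ᶠ∩-local S (bag σ i x) j apart)) (proj₂ (sols j) x x∈Tⱼ)
    where
    apart : ∀ l → l ≢ j → ∀ {y} → y ∈ S l → y ∉ bag σ i x
    apart l l≢j y∈Sₗ y∈βx with proj₁ (sols l) _ y∈Sₗ
    ... | z , z∈Tₗ , y∈βz with z ≟ x
    ...   | yes refl = T-disjoint j l (λ j≡l → l≢j (sym j≡l)) z x∈Tⱼ z∈Tₗ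
    ...   | no z≢x   =
      bags-disjoint σ i 1≤i i≤n z x (T⊆V l z∈Tₗ) (T⊆V j x∈Tⱼ) z≢x y∈βz y∈βx

  ⋃ᶠ-solution-bags : ∀ {y} → y ∈ ⋃ᶠ S → ∃ λ j → ∃ λ z → z ∈ PT (πs j) × y ∈ bag σ i z
  ⋃ᶠ-solution-bags y∈⋃ with x∈⋃ᶠ⁻ S y∈⋃
  ... | j , y∈Sⱼ = j , proj₁ (sols j) _ y∈Sⱼ

lemma3p6 : {U : ℕ} (G : Trigraph U) → IsGraph G →
    (n : ℕ) (σ : ContractionSeq G n) (d : ℕ) → HasWidth σ d → (k : ℕ) →
    (i : ℕ) → 2 ≤ i → i ≤ n →
    (v u₁ u₂ : Fin U) → u₁ ≢ u₂ →
    V (Gs σ i) ─ V (Gs σ (i ∸ 1)) ≡ ⁅ v ⁆ →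
    V (Gs σ (i ∸ 1)) ─ V (Gs σ i) ≡ ⁅ u₁ ⁆ ∪ ⁅ u₂ ⁆ →
    (π : ExtProfile σ k d) → IsExtProfile σ k d i π → v ∈ PT π →
    (f' : Fin U → ℕ) → FCompatible σ k d i v u₁ u₂ π f' →
    (m : ℕ) (πs : Fin m → ExtProfile σ k d) →
    IsFDecomposition σ k d i v u₁ u₂ π f' m πs →
    (S : Fin m → Subset U) → (∀ j → IsSolution σ k d (i ∸ 1) (πs j) (S j)) →
    IsSolution σ k d i π (⋃ᶠ S)
lemma3p6 G _ n σ d _ k (suc (suc j)) (s≤s (s≤s z≤n)) i≤n v u₁ u₂ u₁≢u₂ new≡ removed≡
         π _ v∈T f' (_ , _ , f-split , _ , _ , f-kept) m πs F S sols =
  covered , count-lift (⋃ᶠ S) f' (Pf π) u₁≢u₂ count-below f-split f-kept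
  where
  open Step σ j i≤n new≡ removed≡
  open IsFDecomposition F using (exts; f-union; ddecomp)
  open IsDDecomposition ddecomp using (disjoint; cover-T)
  module Glued = Gluing σ k d (suc j) (s≤s z≤n) (≤-trans (n≤1+n _) i≤n) πs
                   (λ l → IsBasicProfile.T⊆V (IsExtProfile.basic (exts l))) disjoint S sols

  covered : ∀ y → y ∈ ⋃ᶠ S → y ∈bags (σ , suc (suc j) , PT π)
  covered y y∈⋃ with Glued.⋃ᶠ-solution-bags y∈⋃
  ... | l , z , z∈Tₗ , y∈βz = ∈bags-lift v∈T (z , Equivalence.from (cover-T z) (l , z∈Tₗ) , y∈βz)

  count-below : ∀ {x} → x ∈ (PT π ─ ⁅ v ⁆) ∪ (⁅ u₁ ⁆ ∪ ⁅ u₂ ⁆) →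
                ∣ ⋃ᶠ S ∩ bag σ (suc j) x ∣ ≡ f' x
  count-below x∈T' with Equivalence.to (cover-T _) x∈T'
  ... | l , x∈Tₗ = trans (Glued.⋃ᶠ-solution-count l x∈Tₗ) (sym (f-union l _ x∈Tₗ))
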